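{- Let $k\geq 2$ and $n\geq 0$. Then \[ \mathcal{O}_{1,k}(n)=\bigcup_{\lambda\in\mathcal{O}_k(n)}\ \bigcup_{i}\mathcal{O}_{\lambda,k,i}, \] where the inner union runs over the distinct parts $i$ of $\lambda$, and the sets $\mathcal{O}_{\lambda,k,i}$ (for the different pairs $(\lambda,i)$) are pairwise disjoint.
   Context: A partition of $n$ is a finite nonincreasing sequence of positive integers summing to $n$. $\mathcal{O}_k(n)$ is the set of partitions of $n$ with no part divisible by $k$; $\mathcal{O}_{1,k}(n)$ is the set of partitions of $n$ having exactly one distinct part value divisible by $k$ (possibly repeated), all other parts being not divisible by $k$. For a positive integer $m$ with base-$k$ expansion $m=b_1k^{a_1}+\cdots+b_pk^{a_p}$ ($a_1>\cdots>a_p\geq 0$, $1\leq b_j\leq k-1$), let $a(m)=a_1$. For $\lambda\in\mathcal{O}_k(n)$ and a part $i$ of $\lambda$ of multiplicity $m_i$, for integers $1\leq j\leq a(m_i)$ and $1\leq r\leq\lfloor m_i/k^j\rfloor$ let $\pi^i_{j,r}$ be the partition obtained from $\lambda$ by replacing $r\cdot k^j$ of the parts equal to $i$ by $r$ parts equal to $i\cdot k^j$. Define $\mathcal{O}_{\lambda,k,i}=\{\pi^i_{j,r}:1\leq j\leq a(m_i),\ 1\leq r\leq\lfloor m_i/k^j\rfloor\}$ (empty if $m_i<k$). -}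

module Defs where

open import Data.Nat using (ℕ; zero; suc; _+_; _*_; _^_; _≤_; _<_; _≥_; _<?_; NonZero)
open import Data.Nat.Properties using (_≟_; m^n≢0)
open import Data.Nat.DivMod using (_/_)
open import Data.Nat.Divisibility using (_∣_)
open import Data.Nat.ListAction using (sum)
open import Data.List using (List; length; filter; replicate; _++_)
open import Data.List.Relation.Unary.All using (All)
open import Data.List.Relation.Unary.Linked using (Linked)
open import Data.List.Membership.Propositional using (_∈_)
open import Data.List.Relation.Binary.Permutation.Propositional using (_↭_)
open import Data.Product using (Σ; _×_; ∃; ∃-syntax)
open import Relation.Nullary using (¬_; yes; no)
open import Relation.Binary.PropositionalEquality using (_≡_)

IsPartition : ℕ → List ℕ → Set
IsPartition n xs = All (λ x → 0 < x) xs × Linked _≥_ xs × sum xs ≡ n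

InO : ℕ → ℕ → List ℕ → Set
InO k n xs = IsPartition n xs × All (λ x → ¬ (k ∣ x)) xs

InO1 : ℕ → ℕ → List ℕ → Set
InO1 k n xs = IsPartition n xs ×
  (∃[ d ] (d ∈ xs × k ∣ d × All (λ x → k ∣ x → x ≡ d) xs))

mult : ℕ → List ℕ → ℕ
mult i xs = length (filter (i ≟_) xs)

-- leading exponent of the base-k expansion, computed with fuel:
-- if m < k then 0 else 1 + lead (m / k).
leadFuel : (k : ℕ) → .{{NonZero k}} → ℕ → ℕ → ℕ
leadFuel k zero m = zero
leadFuel k (suc f) m with m <? k
... | yes _ = zero
... | no _ = suc (leadFuel k f (m / k))

a : (k : ℕ) → .{{NonZero k}} → ℕ → ℕ
a k m = leadFuel k m m

divPow : (k : ℕ) → .{{NonZero k}} → ℕ → ℕ → ℕ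
divPow k j m = _/_ m (k ^ j) {{m^n≢0 k j}}

IsReplacement : (k : ℕ) → List ℕ → ℕ → ℕ → ℕ → List ℕ → Set
IsReplacement k lam i j r π =
  IsPartition (sum lam) π ×
  (∃[ rest ] ((lam ↭ (replicate (r * k ^ j) i ++ rest)) ×
              (π ↭ (replicate r (i * k ^ j) ++ rest))))

InOλ : (k : ℕ) → .{{NonZero k}} → List ℕ → ℕ → List ℕ → Set
InOλ k lam i π =
  ∃[ j ] ∃[ r ] (1 ≤ j × j ≤ a k (mult i lam) ×
                 1 ≤ r × r ≤ divPow k j (mult i lam) ×
                 IsReplacement k lam i j r π)

-- Every positive d divisible by k factors uniquely as d = i * k ^ j with k ∤ i and j ≥ 1.
-- If the only multiple of k in π is d, occurring r times, expanding those r parts into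
-- r * k ^ j parts equal to i gives λ ∈ 𝒪_k(n) with m_i(λ) ≥ r * k ^ j, which is exactly the
-- range 1 ≤ j ≤ a(m_i), 1 ≤ r ≤ ⌊m_i / k^j⌋; conversely such a replacement leaves i * k ^ j as
-- the only multiple of k. For disjointness, π determines d, hence (i, j) by uniqueness of the
-- factorisation, then r and the remaining parts, so λ is determined up to order, and both
-- candidates are sorted.
module Submission where

open import Defs
open import Data.Nat using (ℕ; _≤_; NonZero)
open import Data.List using (List)
open import Data.List.Membership.Propositional using (_∈_)
open import Data.Product using (_×_; ∃-syntax)
open import Function.Bundles using (_⇔_; mk⇔)
open import Relation.Binary.PropositionalEquality using (_≡_)

open import Data.Nat using (zero; suc; _+_; _*_; _^_; _<_; _≥_; _<?_; z≤n; s≤s; z<s; _/_; >-nonZero)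
open import Data.Nat.Properties
open import Data.Nat.DivMod using (m*n/n≡m; /-monoˡ-≤; m/n<m)
open import Data.Nat.Divisibility using (_∣_; divides; _∣?_; _∣0; m∣m*n; ∣n⇒∣m*n)
open import Data.Nat.Induction using (<-wellFounded)
open import Data.Nat.ListAction using (sum)
open import Data.Nat.ListAction.Properties using (sum-++; sum-↭)
open import Data.List using ([]; _∷_; _++_; replicate)
open import Data.List.Properties using (filter-accept)
open import Data.List.Relation.Unary.All as All using (All; []; _∷_)
open import Data.List.Relation.Unary.All.Properties using (++⁺; ++⁻ʳ; replicate⁺)
open import Data.List.Relation.Unary.Any using (here)
open import Data.List.Relation.Unary.Linked using (Linked)
open import Data.List.Relation.Binary.Permutation.Propositional
  using (_↭_; ↭⇒↭ₛ; ↭-sym; ↭-trans; ↭-refl; prep)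
open import Data.List.Relation.Binary.Permutation.Propositional.Properties
  using (drop-∷; ∈-resp-↭; All-resp-↭; ++⁺ˡ; shift; ↭-length; filter-↭)
open import Data.List.Relation.Binary.Pointwise using (Pointwise-≡⇒≡)
open import Data.Product using (_,_; proj₁; proj₂)
open import Data.Empty using (⊥-elim)
open import Induction.WellFounded using (Acc; acc)
open import Relation.Nullary using (¬_; yes; no)
open import Relation.Binary.PropositionalEquality using (refl; sym; trans; cong; subst; _≢_; module ≡-Reasoning)
import Relation.Binary.Construct.Flip.EqAndOrd as Flip
import Data.List.Sort as Sort
import Data.List.Relation.Unary.Sorted.TotalOrder.Properties as Sorted

module Desc = Sort (Flip.decTotalOrder ≤-decTotalOrder)

descending-↭⇒≡ : ∀ {xs ys} → Linked _≥_ xs → Linked _≥_ ys → xs ↭ ys → xs ≡ ys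
descending-↭⇒≡ xs↘ ys↘ xs↭ys =
  Pointwise-≡⇒≡ (Sorted.↗↭↗⇒≋ (Flip.totalOrder ≤-totalOrder) xs↘ ys↘ (↭⇒↭ₛ xs↭ys))

∤⇒>0 : ∀ {m n} → ¬ m ∣ n → 0 < n
∤⇒>0 {m} {zero}  m∤0 = ⊥-elim (m∤0 (m ∣0))
∤⇒>0 {n = suc n} _   = z<s

m*n≤o⇒m≤o/n : ∀ m n o .{{_ : NonZero n}} → m * n ≤ o → m ≤ o / n
m*n≤o⇒m≤o/n m n o m*n≤o = subst (_≤ o / n) (m*n/n≡m m n) (/-monoˡ-≤ n m*n≤o)

sum-replicate : ∀ n x → sum (replicate n x) ≡ n * x
sum-replicate zero    x = refl
sum-replicate (suc n) x = cong (x +_) (sum-replicate n x)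

sum-replicate-regroup : ∀ r m i → sum (replicate (r * m) i) ≡ sum (replicate r (i * m))
sum-replicate-regroup r m i = begin
  sum (replicate (r * m) i)  ≡⟨ sum-replicate (r * m) i ⟩
  r * m * i                  ≡⟨ *-assoc r m i ⟩
  r * (m * i)                ≡⟨ cong (r *_) (*-comm m i) ⟩
  r * (i * m)                ≡⟨ sum-replicate r (i * m) ⟨
  sum (replicate r (i * m))  ∎
  where open ≡-Reasoning

∈-replicate-++ : ∀ {A : Set} {x : A} {n} ys → 1 ≤ n → x ∈ replicate n x ++ ys
∈-replicate-++ {n = suc n} ys _ = here refl

All-↭-++⁻ʳ : ∀ {A : Set} {P : A → Set} {xs} ys {zs} → All P xs → xs ↭ ys ++ zs → All P zs
All-↭-++⁻ʳ ys Pxs xs↭ = ++⁻ʳ ys (All-resp-↭ xs↭ Pxs)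

replicate-++-cancel : ∀ {A : Set} {d : A} r r′ {rest rest′} → All (_≢ d) rest → All (_≢ d) rest′ →
  replicate r d ++ rest ↭ replicate r′ d ++ rest′ → r ≡ r′ × rest ↭ rest′
replicate-++-cancel zero zero _ _ p = refl , p
replicate-++-cancel zero (suc r′) ≢d _ p = ⊥-elim (All.lookup ≢d (∈-resp-↭ (↭-sym p) (here refl)) refl)
replicate-++-cancel (suc r) zero _ ≢d′ p = ⊥-elim (All.lookup ≢d′ (∈-resp-↭ p (here refl)) refl)
replicate-++-cancel (suc r) (suc r′) ≢d ≢d′ p with replicate-++-cancel r r′ ≢d ≢d′ (drop-∷ p)
... | refl , rest↭rest′ = refl , rest↭rest′

separate : (d : ℕ) (xs : List ℕ) → ∃[ r ] ∃[ rest ] (xs ↭ replicate r d ++ rest × All (_≢ d) rest)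
separate d [] = 0 , [] , ↭-refl , []
separate d (x ∷ xs) with separate d xs | x ≟ d
... | r , rest , p , ≢d | yes refl = suc r , rest , prep d p , ≢d
... | r , rest , p , ≢d | no x≢d =
  r , x ∷ rest , ↭-trans (prep x p) (↭-sym (shift x (replicate r d) rest)) , x≢d ∷ ≢d

mult-↭ : ∀ i {xs ys} → xs ↭ ys → mult i xs ≡ mult i ys
mult-↭ i xs↭ys = ↭-length (filter-↭ (i ≟_) xs↭ys)

replicate≤mult : ∀ n i ys → n ≤ mult i (replicate n i ++ ys)
replicate≤mult zero    i ys = z≤n
replicate≤mult (suc n) i ys rewrite filter-accept (i ≟_) {xs = replicate n i ++ ys} (refl {x = i}) =
  s≤s (replicate≤mult n i ys)

module _ {k : ℕ} .{{_ : NonZero k}} where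

  *-^-suc : ∀ i j → i * k ^ suc j ≡ i * k ^ j * k
  *-^-suc i j = trans (cong (i *_) (*-comm k (k ^ j))) (sym (*-assoc i (k ^ j) k))

  k∣*^ : ∀ i j → 1 ≤ j → k ∣ i * k ^ j
  k∣*^ i (suc j) _ = ∣n⇒∣m*n i (m∣m*n (k ^ j))

  All-∤⇒All-≢ : ∀ {d xs} → k ∣ d → All (λ x → ¬ k ∣ x) xs → All (_≢ d) xs
  All-∤⇒All-≢ k∣d = All.map (λ k∤x x≡d → k∤x (subst (k ∣_) (sym x≡d) k∣d))

  factor-powers : 2 ≤ k → ∀ d → 0 < d → ∃[ i ] ∃[ j ] (d ≡ i * k ^ j × ¬ k ∣ i)
  factor-powers k≥2 d d>0 = go d d>0 (<-wellFounded d)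
    where
    go : ∀ d → 0 < d → Acc _<_ d → ∃[ i ] ∃[ j ] (d ≡ i * k ^ j × ¬ k ∣ i)
    go d _ _ with k ∣? d
    go d _ _ | no k∤d = d , 0 , sym (*-identityʳ d) , k∤d
    go .(q * k) _ (acc rec) | yes (divides q@(suc _) refl) with go q z<s (rec (m<m*n q k k≥2))
    ... | i , j , q≡ik^j , k∤i = i , suc j , trans (cong (_* k) q≡ik^j) (sym (*-^-suc i j)) , k∤i

  *-^-injective : ∀ {i i′} j j′ → ¬ k ∣ i → ¬ k ∣ i′ → i * k ^ j ≡ i′ * k ^ j′ → i ≡ i′ × j ≡ j′
  *-^-injective {i} {i′} zero zero _ _ e =
    trans (sym (*-identityʳ i)) (trans e (*-identityʳ i′)) , refl
  *-^-injective {i} {i′} zero (suc j′) k∤i _ e =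
    ⊥-elim (k∤i (subst (k ∣_) (trans (sym e) (*-identityʳ i)) (k∣*^ i′ (suc j′) (s≤s z≤n))))
  *-^-injective {i} {i′} (suc j) zero _ k∤i′ e =
    ⊥-elim (k∤i′ (subst (k ∣_) (trans e (*-identityʳ i′)) (k∣*^ i (suc j) (s≤s z≤n))))
  *-^-injective {i} {i′} (suc j) (suc j′) k∤i k∤i′ e
    with *-^-injective j j′ k∤i k∤i′
           (*-cancelʳ-≡ (i * k ^ j) (i′ * k ^ j′) k (trans (sym (*-^-suc i j)) (trans e (*-^-suc i′ j′))))
  ... | i≡i′ , j≡j′ = i≡i′ , cong suc j≡j′

  ^≤⇒≤leadFuel : 2 ≤ k → ∀ f m j → k ^ j ≤ m → m ≤ f → j ≤ leadFuel k f m
  ^≤⇒≤leadFuel _ f m zero _ _ = z≤n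
  ^≤⇒≤leadFuel _ zero m (suc j) k^j≤m m≤0 = ⊥-elim (<⇒≱ (m^n>0 k (suc j)) (≤-trans k^j≤m m≤0))
  ^≤⇒≤leadFuel k≥2 (suc f) m (suc j) k^j≤m m≤f with m <? k
  ... | yes m<k = ⊥-elim (<⇒≱ m<k (≤-trans (m≤m*n k (k ^ j) {{m^n≢0 k j}}) k^j≤m))
  ... | no _    = s≤s (^≤⇒≤leadFuel k≥2 f (m / k) j k^j≤m/k m/k≤f)
    where
    k^j≤m/k : k ^ j ≤ m / k
    k^j≤m/k = m*n≤o⇒m≤o/n (k ^ j) k m (subst (_≤ m) (*-comm k (k ^ j)) k^j≤m)
    m/k≤f : m / k ≤ f
    m/k≤f = ≤-pred (≤-trans (m/n<m m k {{>-nonZero (≤-trans (m^n>0 k (suc j)) k^j≤m)}} k≥2) m≤f)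

  ^≤⇒≤a : 2 ≤ k → ∀ m j → k ^ j ≤ m → j ≤ a k m
  ^≤⇒≤a k≥2 m j k^j≤m = ^≤⇒≤leadFuel k≥2 m m j k^j≤m ≤-refl

  replacement-bounds : 2 ≤ k → ∀ {m j r} → 1 ≤ r → r * k ^ j ≤ m → j ≤ a k m × r ≤ divPow k j m
  replacement-bounds k≥2 {m} {j} {r} r≥1 rk^j≤m =
    ^≤⇒≤a k≥2 m j (≤-trans (m≤n*m (k ^ j) r {{>-nonZero r≥1}}) rk^j≤m) ,
    m*n≤o⇒m≤o/n r (k ^ j) m {{m^n≢0 k j}} rk^j≤m

  replacement-unique-multiple : ∀ {lam π i j r rest} → All (λ x → ¬ k ∣ x) lam → 1 ≤ j → 1 ≤ r →
    lam ↭ replicate (r * k ^ j) i ++ rest → π ↭ replicate r (i * k ^ j) ++ rest →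
    i * k ^ j ∈ π × All (λ x → k ∣ x → x ≡ i * k ^ j) π
  replacement-unique-multiple {i = i} {j} {r} {rest} lam∤ j≥1 r≥1 lam↭ π↭ =
    ∈-resp-↭ (↭-sym π↭) (∈-replicate-++ rest r≥1) ,
    All-resp-↭ (↭-sym π↭) (++⁺ (replicate⁺ r (λ _ → refl)) (All.map (λ k∤x k∣x → ⊥-elim (k∤x k∣x)) rest∤))
    where
    rest∤ : All (λ x → ¬ k ∣ x) rest
    rest∤ = All-↭-++⁻ʳ (replicate (r * k ^ j) i) lam∤ lam↭

  InOλ⇒InO1 : ∀ {n lam i π} → InO k n lam → InOλ k lam i π → InO1 k n π
  InOλ⇒InO1 {i = i} ((_ , _ , Σlam≡n) , lam∤)
            (j , r , j≥1 , _ , r≥1 , _ , ((π>0 , π↘ , Σπ≡Σlam) , _ , lam↭ , π↭))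
    with replacement-unique-multiple lam∤ j≥1 r≥1 lam↭ π↭
  ... | d∈π , onlyd = (π>0 , π↘ , trans Σπ≡Σlam Σlam≡n) , _ , d∈π , k∣*^ i j j≥1 , onlyd

  expand : ℕ → ℕ → ℕ → List ℕ → List ℕ
  expand i j r rest = Desc.sort (replicate (r * k ^ j) i ++ rest)

  expand-InOλ : 2 ≤ k → ∀ {n π i j r rest} → IsPartition n π → ¬ k ∣ i → 1 ≤ j → 1 ≤ r →
    π ↭ replicate r (i * k ^ j) ++ rest → All (λ x → ¬ k ∣ x) rest → All (0 <_) rest →
    InO k n (expand i j r rest) × i ∈ expand i j r rest × InOλ k (expand i j r rest) i π
  expand-InOλ k≥2 {n} {π} {i} {j} {r} {rest} (π>0 , π↘ , Σπ≡n) k∤i j≥1 r≥1 π↭ rest∤ rest>0 =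
    ((lam>0 , Desc.sort-↗ lam₀ , Σlam≡n) , lam∤) ,
    ∈-resp-↭ (↭-sym lam↭) (∈-replicate-++ rest rk^j≥1) ,
    (j , r , j≥1 , proj₁ bounds , r≥1 , proj₂ bounds ,
     ((π>0 , π↘ , trans Σπ≡n (sym Σlam≡n)) , rest , lam↭ , π↭))
    where
    lam₀ = replicate (r * k ^ j) i ++ rest
    lam = Desc.sort lam₀
    lam↭ : lam ↭ lam₀
    lam↭ = Desc.sort-↭ lam₀
    lam>0 : All (0 <_) lam
    lam>0 = All-resp-↭ (↭-sym lam↭) (++⁺ (replicate⁺ (r * k ^ j) (∤⇒>0 k∤i)) rest>0)
    lam∤ : All (λ x → ¬ k ∣ x) lam
    lam∤ = All-resp-↭ (↭-sym lam↭) (++⁺ (replicate⁺ (r * k ^ j) k∤i) rest∤)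
    Σlam≡n : sum lam ≡ n
    Σlam≡n = begin
      sum lam                                   ≡⟨ sum-↭ lam↭ ⟩
      sum lam₀                                  ≡⟨ sum-++ (replicate (r * k ^ j) i) rest ⟩
      sum (replicate (r * k ^ j) i) + sum rest  ≡⟨ cong (_+ sum rest) (sum-replicate-regroup r (k ^ j) i) ⟩
      sum (replicate r (i * k ^ j)) + sum rest  ≡⟨ sum-++ (replicate r (i * k ^ j)) rest ⟨
      sum (replicate r (i * k ^ j) ++ rest)     ≡⟨ sum-↭ π↭ ⟨
      sum π                                     ≡⟨ Σπ≡n ⟩
      n                                         ∎
      where open ≡-Reasoning
    rk^j≥1 : 1 ≤ r * k ^ j
    rk^j≥1 = ≤-trans (m^n>0 k j) (m≤n*m (k ^ j) r {{>-nonZero r≥1}})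
    rk^j≤mult : r * k ^ j ≤ mult i lam
    rk^j≤mult = subst (r * k ^ j ≤_) (mult-↭ i (↭-sym lam↭)) (replicate≤mult (r * k ^ j) i rest)
    bounds : j ≤ a k (mult i lam) × r ≤ divPow k j (mult i lam)
    bounds = replacement-bounds k≥2 r≥1 rk^j≤mult

  InO1⇒InOλ : 2 ≤ k → ∀ {n π} → InO1 k n π → ∃[ lam ] ∃[ i ] (InO k n lam × i ∈ lam × InOλ k lam i π)
  InO1⇒InOλ k≥2 {π = π} (π-part@(π>0 , _ , _) , d , d∈π , k∣d , onlyd)
    with factor-powers k≥2 d (All.lookup π>0 d∈π) | separate d π
  ... | i , zero , d≡i , k∤i | _ = ⊥-elim (k∤i (subst (k ∣_) (trans d≡i (*-identityʳ i)) k∣d))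
  ... | _ , suc _ , _ , _ | zero , _ , π↭ , ≢d = ⊥-elim (All.lookup ≢d (∈-resp-↭ π↭ d∈π) refl)
  ... | i , suc j , refl , k∤i | suc r , rest , π↭ , ≢d =
    _ , i , expand-InOλ k≥2 {j = suc j} π-part k∤i (s≤s z≤n) (s≤s z≤n) π↭ rest∤
                        (All-↭-++⁻ʳ (replicate (suc r) d) π>0 π↭)
    where
    rest∤ : All (λ x → ¬ k ∣ x) rest
    rest∤ = All.zipWith (λ (x≢d , onlyd-x) k∣x → x≢d (onlyd-x k∣x))
                        (≢d , All-↭-++⁻ʳ (replicate (suc r) d) onlyd π↭)

  InOλ-unique : ∀ {n lam lam′ i i′ π} → InO k n lam → InO k n lam′ → i ∈ lam → i′ ∈ lam′ →
    InOλ k lam i π → InOλ k lam′ i′ π → lam ≡ lam′ × i ≡ i′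
  InOλ-unique {i = i} ((_ , lam↘ , _) , lam∤) ((_ , lam′↘ , _) , lam′∤) i∈lam i′∈lam′
    (j , r , j≥1 , _ , r≥1 , _ , (_ , rest , lam↭ , π↭))
    (j′ , r′ , j′≥1 , _ , r′≥1 , _ , (_ , rest′ , lam′↭ , π↭′))
    with replacement-unique-multiple lam∤ j≥1 r≥1 lam↭ π↭
       | replacement-unique-multiple lam′∤ j′≥1 r′≥1 lam′↭ π↭′
  ... | d∈π , _ | _ , onlyd′
    with *-^-injective j j′ (All.lookup lam∤ i∈lam) (All.lookup lam′∤ i′∈lam′)
           (All.lookup onlyd′ d∈π (k∣*^ i j j≥1))
  ... | refl , refl
    with replicate-++-cancel r r′ (All-∤⇒All-≢ (k∣*^ i j j≥1) (All-↭-++⁻ʳ _ lam∤ lam↭))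
                                  (All-∤⇒All-≢ (k∣*^ i j j≥1) (All-↭-++⁻ʳ _ lam′∤ lam′↭))
                                  (↭-trans (↭-sym π↭) π↭′)
  ... | refl , rest↭rest′ =
    descending-↭⇒≡ lam↘ lam′↘
      (↭-trans lam↭ (↭-trans (++⁺ˡ (replicate (r * k ^ j) i) rest↭rest′) (↭-sym lam′↭))) ,
    refl

theorem3p3 : (k : ℕ) → .{{_ : NonZero k}} → 2 ≤ k → (n : ℕ) →
    ((π : List ℕ) →
      InO1 k n π ⇔ (∃[ lam ] ∃[ i ] (InO k n lam × i ∈ lam × InOλ k lam i π)))
    × ((lam lam′ : List ℕ) (i i′ : ℕ) (π : List ℕ) →
      InO k n lam → InO k n lam′ → i ∈ lam → i′ ∈ lam′ →
      InOλ k lam i π → InOλ k lam′ i′ π → (lam ≡ lam′ × i ≡ i′))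
theorem3p3 k k≥2 n =
  (λ π → mk⇔ (InO1⇒InOλ k≥2) (λ (_ , _ , lam∈O , _ , π∈Oλ) → InOλ⇒InO1 lam∈O π∈Oλ)) ,
  (λ _ _ _ _ _ → InOλ-unique)
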